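{- Suppose that $0<\varepsilon<\frac12$, $I\subseteq\omega$ is finite and $A\subseteq 2^{2^I}$ satisfies $|A|/|2^{2^I}|\geq\varepsilon$. Let $$Z=\Big\{s\in 2^I: \exists i_s\in\{0,1\}\ \frac{|\{f\in A: f(s)=i_s\}|}{|2^{2^I}|}<\varepsilon^3\Big\}.$$ Then $|Z|\leq 1/\varepsilon$.
   Context: $2^I$ is the set of functions from $I$ to $\{0,1\}$ and $2^{2^I}$ is the set of functions from $2^I$ to $\{0,1\}$. -}

module Defs where

open import Data.Bool using (Bool; true; false; if_then_else_)
open import Data.Nat using (ℕ; zero; suc; _^_)
open import Data.Nat.Properties using (m^n≢0)
open import Data.Fin using (Fin; zero; suc)
open import Data.List using (List; []; _∷_; _++_; concatMap; map; length; filter)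
open import Data.Integer using (+_)
open import Data.Rational using (ℚ; _/_; 0ℚ; _<_; 1/_; positive)
open import Data.Rational.Properties using (pos⇒nonZero)
open import Data.Product using (∃)
open import Relation.Nullary using (Dec; yes; no)
open import Relation.Nullary.Decidable using (_⊎-dec_)
open import Relation.Unary using (Decidable)
open import Relation.Binary.PropositionalEquality using (_≡_)

-- I is a finite subset of ω; identified with Fin n (n = |I|).
-- 2^I : functions I → {0,1}, with {0,1} = Bool (false = 0, true = 1).
2^ : ℕ → Set
2^ n = Fin n → Bool

2^2^ : ℕ → Set
2^2^ n = 2^ n → Bool

-- Enumeration of 2^I (each function exactly once, up to pointwise equality).
all2^ : (n : ℕ) → List (2^ n)
all2^ zero = (λ ()) ∷ []
all2^ (suc n) = concatMap (λ s → ext false s ∷ ext true s ∷ []) (all2^ n)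
  where
  ext : Bool → 2^ n → 2^ (suc n)
  ext b s zero = b
  ext b s (suc i) = s i

-- Enumeration of 2^{2^I} (each function exactly once, up to pointwise equality).
all2^2^ : (n : ℕ) → List (2^2^ n)
all2^2^ zero = (λ _ → false) ∷ (λ _ → true) ∷ []
all2^2^ (suc n) =
  concatMap (λ f₀ → map (λ f₁ → glue f₀ f₁) (all2^2^ n)) (all2^2^ n)
  where
  glue : 2^2^ n → 2^2^ n → 2^2^ (suc n)
  glue f₀ f₁ s = if s zero then f₁ (λ i → s (suc i)) else f₀ (λ i → s (suc i))

card2^ : (n : ℕ) {P : 2^ n → Set} → Decidable P → ℕ
card2^ n P? = length (filter P? (all2^ n))

card2^2^ : (n : ℕ) {P : 2^2^ n → Set} → Decidable P → ℕ
card2^2^ n P? = length (filter P? (all2^2^ n))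

size2^2^ : ℕ → ℕ
size2^2^ n = 2 ^ (2 ^ n)

over2^2^ : ℕ → (n : ℕ) → ℚ
over2^2^ k n = (+ k) / size2^2^ n
  where instance _ = m^n≢0 2 (2 ^ n)

-- A ⊆ 2^{2^I} given as a characteristic function; f ∈ A iff A f ≡ true.
Mem : {n : ℕ} → (2^2^ n → Bool) → 2^2^ n → Set
Mem A f = A f ≡ true

open import Data.Bool using (_≟_; _∧_)

mem? : {n : ℕ} (A : 2^2^ n → Bool) → Decidable (Mem A)
mem? A f = A f ≟ true

memAt? : {n : ℕ} (A : 2^2^ n → Bool) (s : 2^ n) (i : Bool) →
         Decidable (λ f → A f ≡ true Data.Product.× f s ≡ i)
memAt? A s i f = Relation.Nullary.Decidable._×-dec_ (A f ≟ true) (f s ≟ i)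

InZ : {n : ℕ} → ℚ → (2^2^ n → Bool) → 2^ n → Set
InZ {n} ε A s = ∃ λ (i : Bool) → over2^2^ (card2^2^ n (memAt? A s i)) n < ε Data.Rational.* ε Data.Rational.* ε

InZ? : {n : ℕ} (ε : ℚ) (A : 2^2^ n → Bool) → Decidable (InZ ε A)
InZ? {n} ε A s with over2^2^ (card2^2^ n (memAt? A s false)) n Data.Rational.<? ε Data.Rational.* ε Data.Rational.* ε
... | yes p = yes (false Data.Product., p)
... | no ¬p with over2^2^ (card2^2^ n (memAt? A s true)) n Data.Rational.<? ε Data.Rational.* ε Data.Rational.* ε
...   | yes q = yes (true Data.Product., q)
...   | no ¬q = no λ { (false Data.Product., p) → ¬p p ; (true Data.Product., q) → ¬q q }

inv : (ε : ℚ) → 0ℚ < ε → ℚ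
inv ε pos = 1/ ε
  where instance
    _ = positive pos
    _ = pos⇒nonZero ε

-- Write ε = P/Q in lowest terms and suppose |Z| > Q/P. Take k = ⌊Q/P⌋ + 1 points s of Z, each with
-- a value i_s such that {f ∈ A : f(s) = i_s} has density < ε³. A member of A either lies in one of
-- these k sets or avoids all k values, and since the points are distinct exactly a 2⁻ᵏ fraction of
-- all f avoid them (split 2^{2^I} along one coordinate of I and induct). Hence ε ≤ 2⁻ᵏ + k ε³, i.e.
-- 2ᵏ P Q² ≤ Q³ + 2ᵏ k P³. But (k - 1) P ≤ Q < k P and 2P < Q force k ≥ 3 and the reverse strict
-- inequality: for k = 3 because 8PQ² - Q³ - 24P³ = (Q - 2P)(12P² + 6PQ - Q²), and for k ≥ 4
-- because then 2kP² ≤ Q² and k ≤ 2ᵏ⁻¹.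

module Submission where

open import Defs
open import Data.Bool using (Bool; true; false; _∧_; not; if_then_else_; T)
open import Data.List using (List; []; _∷_; _++_; map; concatMap; length; filter; take)
open import Data.List.Relation.Unary.All as All using (All; []; _∷_)
open import Data.List.Relation.Unary.AllPairs as AllPairs using (AllPairs; []; _∷_)
import Data.List.Relation.Unary.All.Properties as All
import Data.List.Relation.Unary.AllPairs.Properties as AllPairs
open import Data.Product using (_×_; _,_; ∃; proj₁; proj₂; map₁)
open import Data.Empty using (⊥-elim)
open import Function using (_∘_; _on_; Equivalence)
open import Relation.Nullary using (¬_; Dec; does; yes; no)
open import Relation.Unary using (Decidable)
open import Relation.Binary.PropositionalEquality

module Counting where

  open import Data.Bool.ListAction using (all)
  open import Data.Bool.Properties using (T-∧; ∧-assoc; ∧-identityʳ)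
  open import Data.Nat using (ℕ; zero; suc; _+_; _*_; _≤_; z≤n; s≤s)
  open import Data.Nat.ListAction using (sum)
  open import Data.Nat.Properties
  open import Algebra.Properties.CommutativeSemigroup +-commutativeSemigroup using () renaming (x∙yz≈y∙xz to x+[y+z]≡y+[x+z])
  open import Data.Unit using (tt)

  count : {X : Set} → (X → Bool) → List X → ℕ
  count P [] = 0
  count P (x ∷ xs) = if P x then suc (count P xs) else count P xs

  module _ {X : Set} where

    length-filter≡count : {P : X → Set} (P? : Decidable P) (xs : List X) →
                          length (filter P? xs) ≡ count (λ x → does (P? x)) xs
    length-filter≡count P? [] = refl
    length-filter≡count P? (x ∷ xs) with does (P? x)
    ... | true  = cong suc (length-filter≡count P? xs)
    ... | false = length-filter≡count P? xs

    count-cong : {P Q : X → Bool} → P ≗ Q → (xs : List X) → count P xs ≡ count Q xs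
    count-cong P≗Q [] = refl
    count-cong P≗Q (x ∷ xs) rewrite P≗Q x = cong (λ c → if _ then suc c else c) (count-cong P≗Q xs)

    count-mono : {P Q : X → Bool} → (∀ x → T (P x) → T (Q x)) → (xs : List X) → count P xs ≤ count Q xs
    count-mono P⇒Q [] = z≤n
    count-mono {P} {Q} P⇒Q (x ∷ xs) with ih ← count-mono P⇒Q xs | P x | Q x | P⇒Q x
    ... | true  | true  | _   = s≤s ih
    ... | true  | false | P⇒Q = ⊥-elim (P⇒Q tt)
    ... | false | true  | _   = m≤n⇒m≤1+n ih
    ... | false | false | _   = ih

    count-split : (P Q : X → Bool) (xs : List X) →
                  count P xs ≡ count (λ x → P x ∧ Q x) xs + count (λ x → P x ∧ not (Q x)) xs
    count-split P Q [] = refl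
    count-split P Q (x ∷ xs) with ih ← count-split P Q xs | P x | Q x
    ... | true  | true  = cong suc ih
    ... | true  | false = trans (cong suc ih) (sym (+-suc _ _))
    ... | false | _     = ih

    count-false : (xs : List X) → count (λ _ → false) xs ≡ 0
    count-false [] = refl
    count-false (x ∷ xs) = count-false xs

    count-++ : (P : X → Bool) (xs ys : List X) → count P (xs ++ ys) ≡ count P xs + count P ys
    count-++ P [] ys = refl
    count-++ P (x ∷ xs) ys with ih ← count-++ P xs ys | P x
    ... | true  = cong suc ih
    ... | false = ih

  count-map : {X Y : Set} (P : Y → Bool) (f : X → Y) (xs : List X) → count P (map f xs) ≡ count (λ x → P (f x)) xs
  count-map P f [] = refl
  count-map P f (x ∷ xs) = cong (λ c → if P (f x) then suc c else c) (count-map P f xs)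

  count-concatMap-map : {X Y Z : Set} (g : X → Y → Z) {P : Z → Bool} {P₀ : X → Bool} {P₁ : Y → Bool} →
                        (∀ x y → P (g x y) ≡ P₀ x ∧ P₁ y) → (xs : List X) (ys : List Y) →
                        count P (concatMap (λ x → map (g x) ys) xs) ≡ count P₀ xs * count P₁ ys
  count-concatMap-map g split [] ys = refl
  count-concatMap-map g {P} {P₀} {P₁} split (x ∷ xs) ys = begin
    count P (map (g x) ys ++ rest)                             ≡⟨ count-++ P (map (g x) ys) rest ⟩
    count P (map (g x) ys) + count P rest                      ≡⟨ cong₂ _+_ row (count-concatMap-map g split xs ys) ⟩
    count (λ y → P₀ x ∧ P₁ y) ys + count P₀ xs * count P₁ ys  ≡⟨ add-row (P₀ x) ⟩
    count P₀ (x ∷ xs) * count P₁ ys                            ∎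
    where
    open ≡-Reasoning
    rest = concatMap (λ x → map (g x) ys) xs
    row : count P (map (g x) ys) ≡ count (λ y → P₀ x ∧ P₁ y) ys
    row = trans (count-map P (g x) ys) (count-cong (split x) ys)
    add-row : ∀ b → count (λ y → b ∧ P₁ y) ys + count P₀ xs * count P₁ ys ≡
                    (if b then suc (count P₀ xs) else count P₀ xs) * count P₁ ys
    add-row true  = refl
    add-row false = cong (_+ count P₀ xs * count P₁ ys) (count-false ys)

  module _ {X C : Set} (A : X → Bool) (hit : C → X → Bool) (xs : List X) where

    violations : C → ℕ
    violations c = count (λ x → A x ∧ hit c x) xs

    count-≤-avoiders+violations : (cs : List C) →
      count A xs ≤ count (λ x → all (λ c → not (hit c x)) cs) xs + sum (map violations cs)
    count-≤-avoiders+violations cs =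
      ≤-trans (within cs (λ _ B⇒A → B⇒A)) (+-monoˡ-≤ _ (count-mono (λ _ → proj₂ ∘ Equivalence.to T-∧) xs))
      where
      avoidsAll : List C → X → Bool
      avoidsAll cs x = all (λ c → not (hit c x)) cs
      -- Generalised to B ⊆ A, so that the induction can pass from B to B ∧ not (hit c).
      within : (cs : List C) {B : X → Bool} → (∀ x → T (B x) → T (A x)) →
               count B xs ≤ count (λ x → B x ∧ avoidsAll cs x) xs + sum (map violations cs)
      within [] {B} _ = ≤-reflexive (trans (count-cong (λ x → sym (∧-identityʳ (B x))) xs) (sym (+-identityʳ _)))
      within (c ∷ cs) {B} B⇒A = begin
        count B xs
          ≡⟨ count-split B (hit c) xs ⟩
        count (λ x → B x ∧ hit c x) xs + count (λ x → B x ∧ not (hit c x)) xs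
          ≤⟨ +-mono-≤ (count-mono (λ x → Equivalence.from T-∧ ∘ map₁ (B⇒A x) ∘ Equivalence.to T-∧) xs)
                      (within cs (λ x → B⇒A x ∘ proj₁ ∘ Equivalence.to T-∧)) ⟩
        violations c + (count (λ x → (B x ∧ not (hit c x)) ∧ avoidsAll cs x) xs + sum (map violations cs))
          ≡⟨ x+[y+z]≡y+[x+z] (violations c) (count (λ x → (B x ∧ not (hit c x)) ∧ avoidsAll cs x) xs) _ ⟩
        count (λ x → (B x ∧ not (hit c x)) ∧ avoidsAll cs x) xs + (violations c + sum (map violations cs))
          ≡⟨ cong (_+ sum (map violations (c ∷ cs))) (count-cong (λ x → ∧-assoc (B x) _ _) xs) ⟩
        count (λ x → B x ∧ avoidsAll (c ∷ cs) x) xs + sum (map violations (c ∷ cs)) ∎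
        where open ≤-Reasoning

open Counting

module Enumeration where

  open import Algebra using (CommutativeMonoid)
  open import Data.Bool.ListAction using (all)
  open import Data.Bool.Properties using (∧-assoc; ∧-commutativeMonoid)
  open import Algebra.Properties.CommutativeSemigroup (CommutativeMonoid.commutativeSemigroup ∧-commutativeMonoid) using (x∙yz≈y∙xz)
  import Data.Bool as Bool
  open import Data.Fin using (zero; suc)
  open import Data.Nat using (ℕ; zero; suc; _+_; _*_; _^_)
  open import Data.Nat.Properties
  open import Data.Vec.Functional using (head; tail)

  Apart : {n : ℕ} → 2^ n → 2^ n → Set
  Apart s t = ¬ (s ≗ t)

  Apart-tail : {n : ℕ} {s t : 2^ (suc n)} → head s ≡ head t → Apart s t → Apart (tail s) (tail t)
  Apart-tail h≡h s≉t tail≗tail = s≉t λ { zero → h≡h ; (suc i) → tail≗tail i }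

  concatMap-apart : {n : ℕ} (F : 2^ n → List (2^ (suc n))) →
                    (∀ s → All (λ t → tail t ≗ s) (F s)) → (∀ s → AllPairs Apart (F s)) →
                    {ss : List (2^ n)} → AllPairs Apart ss → AllPairs Apart (concatMap F ss)
  concatMap-apart F tails F-apart {ss} ss-apart =
    AllPairs.concat⁺ (All.map⁺ (All.universal F-apart ss)) (AllPairs.map⁺ (AllPairs.map images-apart ss-apart))
    where
    images-apart : ∀ {s t} → Apart s t → All (λ u → All (Apart u) (F t)) (F s)
    images-apart {s} {t} s≉t =
      All.map (λ u≗s → All.map (λ v≗t u≗v → s≉t (λ i → trans (sym (u≗s i)) (trans (u≗v (suc i)) (v≗t i))))
                               (tails t))
              (tails s)

  all2^-apart : (n : ℕ) → AllPairs Apart (all2^ n)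
  all2^-apart zero = [] ∷ []
  all2^-apart (suc n) =
    concatMap-apart _ (λ _ → (λ _ → refl) ∷ (λ _ → refl) ∷ []) (λ _ → ((λ eq → false≢true (eq zero)) ∷ []) ∷ [] ∷ [])
                    (all2^-apart n)
    where
    false≢true : false ≢ true
    false≢true ()

  -- (s , i) is the constraint f s ≢ i on f : 2^2^ n.
  Constraint : ℕ → Set
  Constraint n = 2^ n × Bool

  hits : {n : ℕ} → Constraint n → 2^2^ n → Bool
  hits (s , i) f = does (f s Bool.≟ i)

  avoidsAll : {n : ℕ} → List (Constraint n) → 2^2^ n → Bool
  avoidsAll cs f = all (λ c → not (hits c f)) cs

  Distinct : {n : ℕ} → List (Constraint n) → Set
  Distinct = AllPairs (Apart on proj₁)

  restrict : {n : ℕ} → Bool → List (Constraint (suc n)) → List (Constraint n)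
  restrict b [] = []
  restrict b ((s , i) ∷ cs) = if does (head s Bool.≟ b) then (tail s , i) ∷ restrict b cs else restrict b cs

  -- Definitionally the gluing with which Defs builds all2^2^ (suc n).
  glue : {n : ℕ} → 2^2^ n → 2^2^ n → 2^2^ (suc n)
  glue f₀ f₁ s = if head s then f₁ (tail s) else f₀ (tail s)

  module _ {n : ℕ} where

    avoidsAll-glue : (cs : List (Constraint (suc n))) (f₀ f₁ : 2^2^ n) →
      avoidsAll cs (glue f₀ f₁) ≡ avoidsAll (restrict false cs) f₀ ∧ avoidsAll (restrict true cs) f₁
    avoidsAll-glue [] f₀ f₁ = refl
    avoidsAll-glue ((s , i) ∷ cs) f₀ f₁ with ih ← avoidsAll-glue cs f₀ f₁ | head s
    ... | false = trans (cong (_ ∧_) ih) (sym (∧-assoc (not (hits (tail s , i) f₀)) rest₀ rest₁))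
      where rest₀ = avoidsAll (restrict false cs) f₀; rest₁ = avoidsAll (restrict true cs) f₁
    ... | true  = trans (cong (_ ∧_) ih) (x∙yz≈y∙xz (not (hits (tail s , i) f₁)) rest₀ rest₁)
      where rest₀ = avoidsAll (restrict false cs) f₀; rest₁ = avoidsAll (restrict true cs) f₁

    length-restrict : (cs : List (Constraint (suc n))) →
                      length (restrict false cs) + length (restrict true cs) ≡ length cs
    length-restrict [] = refl
    length-restrict ((s , i) ∷ cs) with ih ← length-restrict cs | head s
    ... | false = cong suc ih
    ... | true  = trans (+-suc _ _) (cong suc ih)

    restrict-apart : (b : Bool) {s : 2^ (suc n)} (cs : List (Constraint (suc n))) → head s ≡ b →
                     All (Apart s ∘ proj₁) cs → All (Apart (tail s) ∘ proj₁) (restrict b cs)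
    restrict-apart b [] _ [] = []
    restrict-apart b ((t , i) ∷ cs) hs≡b (s≉t ∷ s≉cs) with head t Bool.≟ b
    ... | yes ht≡b = Apart-tail (trans hs≡b (sym ht≡b)) s≉t ∷ restrict-apart b cs hs≡b s≉cs
    ... | no _     = restrict-apart b cs hs≡b s≉cs

    restrict-distinct : (b : Bool) (cs : List (Constraint (suc n))) → Distinct cs → Distinct (restrict b cs)
    restrict-distinct b [] [] = []
    restrict-distinct b ((s , i) ∷ cs) (s≉cs ∷ cs-distinct) with head s Bool.≟ b
    ... | yes hs≡b = restrict-apart b cs hs≡b s≉cs ∷ restrict-distinct b cs cs-distinct
    ... | no _     = restrict-distinct b cs cs-distinct

  count-avoidsAll : (n : ℕ) (cs : List (Constraint n)) → Distinct cs →
                       2 ^ length cs * count (avoidsAll cs) (all2^2^ n) ≡ size2^2^ n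
  count-avoidsAll zero [] _ = refl
  count-avoidsAll zero ((s , false) ∷ []) _ = refl
  count-avoidsAll zero ((s , true) ∷ []) _ = refl
  count-avoidsAll zero (_ ∷ _ ∷ _) ((s≉t ∷ _) ∷ _) = ⊥-elim (s≉t λ ())
  count-avoidsAll (suc n) cs cs-distinct = begin
    2 ^ length cs * count (avoidsAll cs) (concatMap (λ f₀ → map (glue f₀) fs) fs)
      ≡⟨ cong₂ (λ k c → 2 ^ k * c) (sym (length-restrict cs))
               (count-concatMap-map glue (avoidsAll-glue cs) fs fs) ⟩
    2 ^ (length cs₀ + length cs₁) * (count (avoidsAll cs₀) fs * count (avoidsAll cs₁) fs)
      ≡⟨ cong (_* (count (avoidsAll cs₀) fs * count (avoidsAll cs₁) fs)) (^-distribˡ-+-* 2 (length cs₀) (length cs₁)) ⟩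
    (2 ^ length cs₀ * 2 ^ length cs₁) * (count (avoidsAll cs₀) fs * count (avoidsAll cs₁) fs)
      ≡⟨ [m*n]*[o*p]≡[m*o]*[n*p] (2 ^ length cs₀) _ _ _ ⟩
    (2 ^ length cs₀ * count (avoidsAll cs₀) fs) * (2 ^ length cs₁ * count (avoidsAll cs₁) fs)
      ≡⟨ cong₂ _*_ (count-avoidsAll n cs₀ (restrict-distinct false cs cs-distinct))
                   (count-avoidsAll n cs₁ (restrict-distinct true cs cs-distinct)) ⟩
    size2^2^ n * size2^2^ n
      ≡⟨ sym (^-distribˡ-+-* 2 (2 ^ n) (2 ^ n)) ⟩
    2 ^ (2 ^ n + 2 ^ n)
      ≡⟨ cong (λ m → 2 ^ (2 ^ n + m)) (sym (+-identityʳ (2 ^ n))) ⟩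
    size2^2^ (suc n) ∎
    where
    open ≡-Reasoning
    fs = all2^2^ n
    cs₀ = restrict false cs
    cs₁ = restrict true cs

open Enumeration

module KeyInequality where

  open import Data.Nat
  open import Data.Nat.Properties
  open import Data.Nat.Tactic.RingSolver using (solve-∀)

  n<2^n : ∀ n → n < 2 ^ n
  n<2^n zero = s≤s z≤n
  n<2^n (suc n) = +-mono-≤-< (m^n>0 2 n) (≤-trans (n<2^n n) (m≤m+n (2 ^ n) 0))

  key-inequality-3 : ∀ p q → 2 * p < q → q < 3 * p → q * q * q + 24 * (p * p * p) < 8 * (p * (q * q))
  key-inequality-3 p q 2p<q q<3p with q ∸ 2 * p | m+[n∸m]≡n (<⇒≤ 2p<q)
  ... | zero  | refl = ⊥-elim (n≮n (2 * p) (subst (2 * p <_) (+-identityʳ (2 * p)) 2p<q))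
  ... | suc o | refl = +-cancelʳ-< (suc o * (q * q)) (q * q * q + 24 * (p * p * p)) (8 * (p * (q * q))) (begin-strict
    q * q * q + 24 * (p * p * p) + d * (q * q)
      <⟨ +-monoʳ-< (q * q * q + 24 * (p * p * p)) (*-monoʳ-< d q²<12p²+6pq) ⟩
    q * q * q + 24 * (p * p * p) + d * (12 * (p * p) + 6 * (p * q))
      ≡⟨ factorisation p d ⟩
    8 * (p * (q * q)) + d * (q * q) ∎)
    where
    open ≤-Reasoning
    d = suc o
    instance
      _ : NonZero q
      _ = >-nonZero (<-≤-trans (s≤s z≤n) 2p<q)
    q²<12p²+6pq : q * q < 12 * (p * p) + 6 * (p * q)
    q²<12p²+6pq = begin-strict
      q * q              <⟨ *-monoˡ-< q q<3p ⟩
      3 * p * q          ≡⟨ *-assoc 3 p q ⟩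
      3 * (p * q)        ≤⟨ *-monoˡ-≤ (p * q) (m≤m+n 3 3) ⟩
      6 * (p * q)        ≤⟨ m≤n+m (6 * (p * q)) (12 * (p * p)) ⟩
      12 * (p * p) + 6 * (p * q) ∎
    factorisation : ∀ p d → let q = 2 * p + d in
      q * q * q + 24 * (p * p * p) + d * (12 * (p * p) + 6 * (p * q)) ≡ 8 * (p * (q * q)) + d * (q * q)
    factorisation = solve-∀

  key-inequality-≥4 : ∀ j p q .{{_ : NonZero q}} → 3 ≤ j → j * p ≤ q → q < suc j * p →
             q * q * q + 2 ^ suc j * suc j * (p * p * p) < 2 ^ suc j * (p * (q * q))
  key-inequality-≥4 j p q 3≤j jp≤q q<kp = begin-strict
    q * q * q + 2 * Y * k * (p * p * p)
      ≡⟨ rearrange₁ q Y k p ⟩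
    q * (q * q) + Y * (2 * k * (p * p)) * p
      <⟨ +-mono-<-≤ (*-monoˡ-< (q * q) q<kp) (*-monoˡ-≤ p (*-monoʳ-≤ Y 2kp²≤q²)) ⟩
    k * p * (q * q) + Y * (q * q) * p
      ≤⟨ +-monoˡ-≤ (Y * (q * q) * p) (*-monoˡ-≤ (q * q) (*-monoˡ-≤ p k≤Y)) ⟩
    Y * p * (q * q) + Y * (q * q) * p
      ≡⟨ rearrange₂ Y p q ⟩
    2 * Y * (p * (q * q)) ∎
    where
    open ≤-Reasoning
    k = suc j
    Y = 2 ^ j
    instance
      _ : NonZero (q * q)
      _ = m*n≢0 q q
    k≤Y : k ≤ Y
    k≤Y = n<2^n j
    2k≤j² : 2 * k ≤ j * j
    2k≤j² = begin
      2 * suc j  ≡⟨ *-suc 2 j ⟩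
      2 + 2 * j  ≤⟨ +-monoˡ-≤ (2 * j) (≤-trans (n≤1+n 2) 3≤j) ⟩
      3 * j      ≤⟨ *-monoˡ-≤ j 3≤j ⟩
      j * j      ∎
    2kp²≤q² : 2 * k * (p * p) ≤ q * q
    2kp²≤q² = begin
      2 * k * (p * p)    ≤⟨ *-monoˡ-≤ (p * p) 2k≤j² ⟩
      j * j * (p * p)    ≡⟨ [m*n]*[o*p]≡[m*o]*[n*p] j j p p ⟩
      j * p * (j * p)    ≤⟨ *-mono-≤ jp≤q jp≤q ⟩
      q * q              ∎
    rearrange₁ : ∀ q Y k p → q * q * q + 2 * Y * k * (p * p * p) ≡ q * (q * q) + Y * (2 * k * (p * p)) * p
    rearrange₁ = solve-∀
    rearrange₂ : ∀ Y p q → Y * p * (q * q) + Y * (q * q) * p ≡ 2 * Y * (p * (q * q))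
    rearrange₂ = solve-∀

  key-inequality : ∀ j p q → 2 * p < q → j * p ≤ q → q < suc j * p →
                   q * q * q + 2 ^ suc j * suc j * (p * p * p) < 2 ^ suc j * (p * (q * q))
  key-inequality 0 p q 2p<q _ q<p = ⊥-elim (<-asym q<p (≤-<-trans (+-monoʳ-≤ p z≤n) 2p<q))
  key-inequality 1 p q 2p<q _ q<2p = ⊥-elim (<-asym q<2p 2p<q)
  key-inequality 2 p q 2p<q _ q<3p = key-inequality-3 p q 2p<q q<3p
  key-inequality j@(suc (suc (suc _))) p q 2p<q jp≤q q<kp =
    key-inequality-≥4 j p q {{>-nonZero (<-≤-trans (s≤s z≤n) 2p<q)}} (s≤s (s≤s (s≤s z≤n))) jp≤q q<kp

open KeyInequality

module Fractions where

  open import Data.Nat as ℕ using (ℕ; suc; NonZero)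
  open import Data.Nat.Properties using (m*n≢0)
  open import Data.Integer as ℤ using (+_)
  import Data.Integer.Properties as ℤ
  open import Data.Rational using (ℚ; _/_; _≤_; _<_; _*_; toℚᵘ)
  open import Data.Rational.Properties using (toℚᵘ-fromℚᵘ; toℚᵘ-mono-≤; toℚᵘ-mono-<; toℚᵘ-cancel-≤; toℚᵘ-homo-*; toℚᵘ-injective)
  open import Data.Rational.Unnormalised as ℚᵘ using (mkℚᵘ; _≃_; *≤*; *<*; *≡*)
  import Data.Rational.Unnormalised.Properties as ℚᵘ

  toℚᵘ-/ : ∀ i n .{{_ : NonZero n}} → toℚᵘ (i / n) ≃ i ℚᵘ./ n
  toℚᵘ-/ i (suc n) = toℚᵘ-fromℚᵘ (mkℚᵘ i n)

  /≤/⇒*≤* : ∀ a b c d .{{_ : NonZero b}} .{{_ : NonZero d}} → + a / b ≤ + c / d → a ℕ.* d ℕ.≤ c ℕ.* b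
  /≤/⇒*≤* a b@(suc _) c d@(suc _) a/b≤c/d
    with ℚᵘ.≤-respʳ-≃ (toℚᵘ-/ (+ c) d) (ℚᵘ.≤-respˡ-≃ (toℚᵘ-/ (+ a) b) (toℚᵘ-mono-≤ a/b≤c/d))
  ... | *≤* ad≤cb = ℤ.drop‿+≤+ (subst₂ ℤ._≤_ (sym (ℤ.pos-* a d)) (sym (ℤ.pos-* c b)) ad≤cb)

  /</⇒*<* : ∀ a b c d .{{_ : NonZero b}} .{{_ : NonZero d}} → + a / b < + c / d → a ℕ.* d ℕ.< c ℕ.* b
  /</⇒*<* a b@(suc _) c d@(suc _) a/b<c/d
    with ℚᵘ.<-respʳ-≃ (toℚᵘ-/ (+ c) d) (ℚᵘ.<-respˡ-≃ (toℚᵘ-/ (+ a) b) (toℚᵘ-mono-< a/b<c/d))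
  ... | *<* ad<cb = ℤ.drop‿+<+ (subst₂ ℤ._<_ (sym (ℤ.pos-* a d)) (sym (ℤ.pos-* c b)) ad<cb)

  *≤*⇒/≤/ : ∀ a b c d .{{_ : NonZero b}} .{{_ : NonZero d}} → a ℕ.* d ℕ.≤ c ℕ.* b → + a / b ≤ + c / d
  *≤*⇒/≤/ a b@(suc _) c d@(suc _) ad≤cb =
    toℚᵘ-cancel-≤ (ℚᵘ.≤-respʳ-≃ (ℚᵘ.≃-sym (toℚᵘ-/ (+ c) d)) (ℚᵘ.≤-respˡ-≃ (ℚᵘ.≃-sym (toℚᵘ-/ (+ a) b))
      (*≤* (subst₂ ℤ._≤_ (ℤ.pos-* a d) (ℤ.pos-* c b) (ℤ.+≤+ ad≤cb)))))

  /*/≡/ : ∀ a b c d .{{_ : NonZero b}} .{{_ : NonZero d}} →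
         (+ a / b) * (+ c / d) ≡ (+ (a ℕ.* c) / (b ℕ.* d)) {{m*n≢0 b d}}
  /*/≡/ a b@(suc _) c d@(suc _) = toℚᵘ-injective (begin
    toℚᵘ (+ a / b * (+ c / d))               ≈⟨ toℚᵘ-homo-* (+ a / b) (+ c / d) ⟩
    toℚᵘ (+ a / b) ℚᵘ.* toℚᵘ (+ c / d)       ≈⟨ ℚᵘ.*-cong (toℚᵘ-/ (+ a) b) (toℚᵘ-/ (+ c) d) ⟩
    (+ a ℚᵘ./ b) ℚᵘ.* (+ c ℚᵘ./ d)           ≈⟨ *≡* (cong (ℤ._* + (b ℕ.* d)) (sym (ℤ.pos-* a c))) ⟩
    + (a ℕ.* c) ℚᵘ./ (b ℕ.* d)               ≈⟨ ℚᵘ.≃-sym (toℚᵘ-/ (+ (a ℕ.* c)) (b ℕ.* d)) ⟩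
    toℚᵘ (+ (a ℕ.* c) / (b ℕ.* d))           ∎)
    where open ℚᵘ.≃-Reasoning

  /-cube : ∀ a b → let q = suc b in (+ a / q) * (+ a / q) * (+ a / q) ≡ + (a ℕ.* a ℕ.* a) / (q ℕ.* q ℕ.* q)
  /-cube a b = trans (cong (_* (+ a / suc b)) (/*/≡/ a (suc b) a (suc b))) (/*/≡/ (a ℕ.* a) (suc b ℕ.* suc b) a (suc b))

open Fractions

module RarePoints where

  open import Data.Nat
  open import Data.Nat.DivMod using (_/_; _%_; m/n*n≤m; m≡m%n+[m/n]*n; m%n<n; m<n*o⇒m/o<n)
  open import Data.Nat.ListAction using (sum)
  open import Data.Nat.Properties
  open import Data.List.Properties using (length-map; length-take)
  open import Data.Nat.Tactic.RingSolver using (solve-∀)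

  sum-map-*-≤ : {X : Set} (f : X → ℕ) (c b : ℕ) (xs : List X) →
                All (λ x → f x * c ≤ b) xs → sum (map f xs) * c ≤ length xs * b
  sum-map-*-≤ f c b [] [] = z≤n
  sum-map-*-≤ f c b (x ∷ xs) (fx*c≤b ∷ rest) = begin
    (f x + sum (map f xs)) * c     ≡⟨ *-distribʳ-+ c (f x) (sum (map f xs)) ⟩
    f x * c + sum (map f xs) * c   ≤⟨ +-mono-≤ fx*c≤b (sum-map-*-≤ f c b xs rest) ⟩
    b + length xs * b              ∎
    where open ≤-Reasoning

  m<[1+m/n]*n : ∀ m n .{{_ : NonZero n}} → m < suc (m / n) * n
  m<[1+m/n]*n m n = begin-strict
    m                  ≡⟨ m≡m%n+[m/n]*n m n ⟩
    m % n + m / n * n  <⟨ +-monoˡ-< (m / n * n) (m%n<n m n) ⟩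
    n + m / n * n      ∎
    where open ≤-Reasoning

  module _ {n : ℕ} (A : 2^2^ n → Bool) (P Q : ℕ) where

    private
      fs = all2^2^ n
      N = size2^2^ n
      instance
        _ : NonZero N
        _ = m^n≢0 2 (2 ^ n)
      member : 2^2^ n → Bool
      member f = does (mem? A f)

    -- ε ≤ 2⁻ᵏ + k ε³ for ε = P/Q and k = length cs, with denominators cleared.
    rare-constraints-bound : (cs : List (Constraint n)) → Distinct cs →
      All (λ c → card2^2^ n (memAt? A (proj₁ c) (proj₂ c)) * (Q * Q * Q) ≤ P * P * P * N) cs →
      P * N ≤ card2^2^ n (mem? A) * Q →
      2 ^ length cs * (P * (Q * Q)) ≤ Q * Q * Q + 2 ^ length cs * length cs * (P * P * P)
    rare-constraints-bound cs distinct rare dense = *-cancelʳ-≤ _ _ N (begin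
      K * (P * (Q * Q)) * N                     ≡⟨ rearrange₁ K P Q N ⟩
      K * (P * N) * (Q * Q)                     ≤⟨ *-monoˡ-≤ (Q * Q) (*-monoʳ-≤ K dense) ⟩
      K * (card2^2^ n (mem? A) * Q) * (Q * Q)   ≡⟨ rearrange₂ K (card2^2^ n (mem? A)) Q ⟩
      K * card2^2^ n (mem? A) * Q³              ≡⟨ cong (λ a → K * a * Q³) (length-filter≡count (mem? A) fs) ⟩
      K * count member fs * Q³                  ≤⟨ *-monoˡ-≤ Q³ (*-monoʳ-≤ K (count-≤-avoiders+violations member hits fs cs)) ⟩
      K * (avoiders + bad) * Q³                 ≡⟨ rearrange₃ K avoiders bad Q³ ⟩
      K * avoiders * Q³ + K * (bad * Q³)        ≤⟨ +-mono-≤ (≤-reflexive (cong (_* Q³) (count-avoidsAll n cs distinct)))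
                                                            (*-monoʳ-≤ K (sum-map-*-≤ (violations member hits fs) Q³ (P * P * P * N) cs
                                                                                      (All.map rare-violations rare))) ⟩
      N * Q³ + K * (k * (P * P * P * N))        ≡⟨ rearrange₄ N Q³ K k (P * P * P) ⟩
      (Q³ + K * k * (P * P * P)) * N            ∎)
      where
      open ≤-Reasoning
      k = length cs
      K = 2 ^ k
      Q³ = Q * Q * Q
      avoiders = count (avoidsAll cs) fs
      bad = sum (map (violations member hits fs) cs)
      rare-violations : ∀ {c} → card2^2^ n (memAt? A (proj₁ c) (proj₂ c)) * Q³ ≤ P * P * P * N →
                        violations member hits fs c * Q³ ≤ P * P * P * N
      rare-violations {c} =
        subst (λ v → v * Q³ ≤ P * P * P * N) (length-filter≡count (memAt? A (proj₁ c) (proj₂ c)) fs)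
      rearrange₁ : ∀ K P Q N → K * (P * (Q * Q)) * N ≡ K * (P * N) * (Q * Q)
      rearrange₁ = solve-∀
      rearrange₂ : ∀ K a Q → K * (a * Q) * (Q * Q) ≡ K * a * (Q * Q * Q)
      rearrange₂ = solve-∀
      rearrange₃ : ∀ K a b c → K * (a + b) * c ≡ K * a * c + K * (b * c)
      rearrange₃ = solve-∀
      rearrange₄ : ∀ N c K k d → N * c + K * (k * (d * N)) ≡ (c + K * k * d) * N
      rearrange₄ = solve-∀

    -- If the bound failed, the first k = ⌊Q/P⌋ + 1 points of ss would violate key-inequality.
    rare-points-bound : .{{_ : NonZero P}} → 2 * P < Q → P * N ≤ card2^2^ n (mem? A) * Q →
      (rare : 2^ n → Bool) (ss : List (2^ n)) → AllPairs Apart ss →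
      All (λ s → card2^2^ n (memAt? A s (rare s)) * (Q * Q * Q) < P * P * P * N) ss →
      length ss * P ≤ Q
    rare-points-bound 2P<Q dense rare ss apart rare-ok with length ss * P ≤? Q
    ... | yes bound = bound
    ... | no ¬bound = ⊥-elim (<⇒≱ (key-inequality j P Q 2P<Q (m/n*n≤m Q P) (m<[1+m/n]*n Q P)) k-bound)
      where
      j = Q / P
      k = suc j
      cs : List (Constraint n)
      cs = map (λ s → s , rare s) (take k ss)
      length-cs : length cs ≡ k
      length-cs = trans (length-map _ (take k ss))
                        (trans (length-take k ss) (m≤n⇒m⊓n≡m (m<n*o⇒m/o<n (≰⇒> ¬bound))))
      k-bound : 2 ^ k * (P * (Q * Q)) ≤ Q * Q * Q + 2 ^ k * k * (P * P * P)
      k-bound = subst (λ m → 2 ^ m * (P * (Q * Q)) ≤ Q * Q * Q + 2 ^ m * m * (P * P * P)) length-cs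
        (rare-constraints-bound cs (AllPairs.map⁺ (AllPairs.take⁺ k apart))
                                   (All.map⁺ (All.take⁺ k (All.map <⇒≤ rare-ok))) dense)

open RarePoints

open import Data.Integer using (+_; +[1+_]; -[1+_]; +<+)
open import Data.Nat as ℕ using (ℕ; suc; NonZero; _^_)
open import Data.Nat.Properties using (m^n≢0; *-comm; *-identityˡ; *-identityʳ)
open import Data.Rational using (ℚ; mkℚ; 0ℚ; ½; _<_; _≤_; _/_; _*_; *<*)
open import Data.Rational.Properties using (↥p/↧p≡p; module ≤-Reasoning)

witnessOr : {X : Set} {P : X → Set} → X → Dec (∃ P) → X
witnessOr _ (yes (x , _)) = x
witnessOr d (no _)        = d

witnessOr-sound : {X : Set} {P : X → Set} (d : X) (P? : Dec (∃ P)) → ∃ P → P (witnessOr d P?)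
witnessOr-sound _ (yes (_ , p)) _  = p
witnessOr-sound _ (no ∄P)       ∃P = ⊥-elim (∄P ∃P)

module _ {n : ℕ} (ε : ℚ) (A : 2^2^ n → Bool) where

  rareValue : 2^ n → Bool
  rareValue s = witnessOr false (InZ? ε A s)

  rareValue-rare : ∀ {s} → InZ ε A s → over2^2^ (card2^2^ n (memAt? A s (rareValue s))) n < ε * ε * ε
  rareValue-rare {s} = witnessOr-sound false (InZ? ε A s)

lemma4 : (ε : ℚ) (ε-pos : 0ℚ < ε) → ε < ½ →
         (n : ℕ) (A : 2^2^ n → Bool) →
         ε ≤ over2^2^ (card2^2^ n (mem? A)) n →
         (+ card2^ n (InZ? ε A)) / 1 ≤ inv ε ε-pos
lemma4 ε@(mkℚ +[1+ a ] b _) ε-pos ε<½ n A ε≤density = begin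
  + card2^ n (InZ? ε A) / 1  ≤⟨ *≤*⇒/≤/ (card2^ n (InZ? ε A)) 1 Q P Z-bound ⟩
  + Q / P                     ≡⟨ ↥p/↧p≡p (inv ε ε-pos) ⟩
  inv ε ε-pos                 ∎
  where
  open ≤-Reasoning
  P = suc a
  Q = suc b
  N = size2^2^ n
  instance
    _ : NonZero N
    _ = m^n≢0 2 (2 ^ n)
  ε≡P/Q : ε ≡ + P / Q
  ε≡P/Q = sym (↥p/↧p≡p ε)
  ε³≡P³/Q³ : ε * ε * ε ≡ + (P ℕ.* P ℕ.* P) / (Q ℕ.* Q ℕ.* Q)
  ε³≡P³/Q³ = trans (cong (λ x → x * x * x) ε≡P/Q) (/-cube P b)
  2P<Q : 2 ℕ.* P ℕ.< Q
  2P<Q = subst₂ ℕ._<_ (*-comm P 2) (*-identityˡ Q) (/</⇒*<* P Q 1 2 (subst (_< ½) ε≡P/Q ε<½))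
  dense : P ℕ.* N ℕ.≤ card2^2^ n (mem? A) ℕ.* Q
  dense = /≤/⇒*≤* P Q (card2^2^ n (mem? A)) N (subst (_≤ over2^2^ (card2^2^ n (mem? A)) n) ε≡P/Q ε≤density)
  rare : ∀ {s} → InZ ε A s →
         card2^2^ n (memAt? A s (rareValue ε A s)) ℕ.* (Q ℕ.* Q ℕ.* Q) ℕ.< P ℕ.* P ℕ.* P ℕ.* N
  rare {s} s∈Z = /</⇒*<* (card2^2^ n (memAt? A s (rareValue ε A s))) N (P ℕ.* P ℕ.* P) (Q ℕ.* Q ℕ.* Q)
    (subst (over2^2^ (card2^2^ n (memAt? A s (rareValue ε A s))) n <_) ε³≡P³/Q³ (rareValue-rare ε A s∈Z))
  Z-bound : card2^ n (InZ? ε A) ℕ.* P ℕ.≤ Q ℕ.* 1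
  Z-bound = subst (card2^ n (InZ? ε A) ℕ.* P ℕ.≤_) (sym (*-identityʳ Q))
    (rare-points-bound A P Q 2P<Q dense (rareValue ε A) (filter (InZ? ε A) (all2^ n))
      (AllPairs.filter⁺ (InZ? ε A) (all2^-apart n)) (All.map rare (All.all-filter (InZ? ε A) (all2^ n))))
lemma4 (mkℚ (+ 0) _ _) (*<* (+<+ ())) _ _ _ _
lemma4 (mkℚ -[1+ _ ] _ _) (*<* ()) _ _ _ _
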